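{- Let $T$ be a nontrivial tree. For every execution of Algorithm 1 on $T$ (any choice of balanced edges), the output coloring is a conflict-free connection coloring of $T$. Moreover, $cfc(T)\le D(T)$, where $D(T)$ is the minimum of the depths $d(T)$ over all executions of Algorithm 1 on $T$.
   Context: For an edge-colored graph, a path is conflict-free if some color occurs on exactly one of its edges; a conflict-free connection coloring of a connected graph is an edge-coloring in which every pair of distinct vertices is joined by a conflict-free path, and $cfc(G)$ is the minimum number of colors in such a coloring. For a tree $T$, an edge $e$ is balanced if the absolute difference of the numbers of edges of the two components of $T-e$ is minimum among all edges of $T$. Algorithm 1: start with the forest $F=T$. While $F$ has a component with more than one vertex, perform an iteration: simultaneously, from each component of $F$ with more than one vertex, delete one balanced edge (balanced with respect to that component); an edge deleted in the $i$-th iteration is colored $i$. The output is this coloring of $E(T)$; the depth $d(T)$ of the execution is the number of iterations performed. -}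

module Defs where

open import Data.Nat using (ℕ; _≤_; _<_; ∣_-_∣)
open import Data.Fin using (Fin)
open import Data.Product using (Σ; ∃; ∃-syntax; _×_; _,_; proj₁; proj₂)
open import Data.Sum using (_⊎_)
open import Data.Unit using (⊤)
open import Data.List using (List; []; _∷_; length; filter)
open import Data.List.Membership.Propositional using (_∈_)
open import Data.List.Relation.Unary.Unique.Propositional using (Unique)
open import Relation.Binary.PropositionalEquality using (_≡_; _≢_)
open import Relation.Nullary using (¬_)
open import Relation.Nullary.Decidable using (⌊_⌋)
open import Data.Nat using (_≟_)
open import Function.Bundles using (_⇔_)

EdgeMap : ℕ → ℕ → Set
EdgeMap n m = Fin m → Fin n × Fin n

module _ {n m : ℕ} (E : EdgeMap n m) where

  Joins : Fin m → Fin n → Fin n → Set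
  Joins e u w = (E e ≡ (u , w)) ⊎ (E e ≡ (w , u))

  Simple : Set
  Simple = (∀ e → proj₁ (E e) ≢ proj₂ (E e))
         × (∀ e f → Joins e (proj₁ (E f)) (proj₂ (E f)) → e ≡ f)

  -- A walk from u to v in the spanning subgraph with edge set S,
  -- with vertex sequence vs (including u and v) and edge sequence es.
  data Walk (S : Fin m → Set) : Fin n → Fin n → List (Fin n) → List (Fin m) → Set where
    here : ∀ {u} → Walk S u u (u ∷ []) []
    step : ∀ {u w v vs es} (e : Fin m) → S e → Joins e u w →
           Walk S w v vs es → Walk S u v (u ∷ vs) (e ∷ es)

  Path : (Fin m → Set) → Fin n → Fin n → List (Fin n) → List (Fin m) → Set
  Path S u v vs es = Walk S u v vs es × Unique vs

  Reach : (Fin m → Set) → Fin n → Fin n → Set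
  Reach S u v = ∃[ vs ] ∃[ es ] Walk S u v vs es

  Connected : (Fin m → Set) → Set
  Connected S = ∀ u v → Reach S u v

  -- A cycle: closed walk u = v0, v1, ..., vk = u with k ≥ 3,
  -- v1, ..., vk pairwise distinct and edges pairwise distinct.
  HasCycle : (Fin m → Set) → Set
  HasCycle S = ∃[ u ] ∃[ vs ] ∃[ es ]
    (Walk S u u (u ∷ vs) es × Unique vs × Unique es × 3 ≤ length es)

  AllEdges : Fin m → Set
  AllEdges _ = ⊤

  IsTree : Set
  IsTree = Simple × Connected AllEdges × ¬ HasCycle AllEdges

  ConflictFree : (Fin m → ℕ) → List (Fin m) → Set
  ConflictFree c es = ∃[ col ] length (filter (λ e → c e ≟ col) es) ≡ 1

  IsCFCColoring : (Fin m → ℕ) → Set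
  IsCFCColoring c = ∀ u v → u ≢ v →
    ∃[ vs ] ∃[ es ] (Path AllEdges u v vs es × ConflictFree c es)

  UsesAtMost : ℕ → (Fin m → ℕ) → Set
  UsesAtMost k c = ∃[ L ] (length L ≤ k × ∀ e → c e ∈ L)

  IsCfc : ℕ → Set
  IsCfc k = (∃[ c ] (UsesAtMost k c × IsCFCColoring c))
          × (∀ j c → UsesAtMost j c → IsCFCColoring c → k ≤ j)

  CountIs : (Fin m → Set) → ℕ → Set
  CountIs P k = ∃[ L ] (Unique L × (∀ f → (f ∈ L) ⇔ P f) × length L ≡ k)

  Minus : (Fin m → Set) → Fin m → Fin m → Set
  Minus S e g = S g × g ≢ e

  SameComp : (Fin m → Set) → Fin m → Fin m → Set
  SameComp S e f = Reach S (proj₁ (E e)) (proj₁ (E f))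

  -- edge f lies in the component of (component of e in S) - e containing vertex x
  OnSide : (Fin m → Set) → Fin m → Fin n → Fin m → Set
  OnSide S e x f = Minus S e f × Reach (Minus S e) x (proj₁ (E f))

  -- the two components of K - e (K the component of e in S) have a and b edges
  Sizes : (Fin m → Set) → Fin m → ℕ → ℕ → Set
  Sizes S e a b = CountIs (OnSide S e (proj₁ (E e))) a
                × CountIs (OnSide S e (proj₂ (E e))) b

  Balanced : (Fin m → Set) → Fin m → Set
  Balanced S e = S e × ∃[ a ] ∃[ b ] (Sizes S e a b ×
    (∀ f → S f → SameComp S e f → ∀ a' b' → Sizes S f a' b' →
       ∣ a - b ∣ ≤ ∣ a' - b' ∣))

  -- edges remaining before iteration i (colored ≥ i)
  Remaining : (Fin m → ℕ) → ℕ → Fin m → Set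
  Remaining c i e = i ≤ c e

  -- c is the output of an execution of Algorithm 1: every color is ≥ 1, and in
  -- iteration i ≥ 1 each component of the current forest having an edge
  -- contains exactly one edge of color i, which is balanced in that component.
  -- (An execution is determined by, and determines, its output coloring:
  -- the edges deleted in iteration i are exactly those of color i.)
  Execution : (Fin m → ℕ) → Set
  Execution c = (∀ e → 1 ≤ c e) ×
    (∀ i → 1 ≤ i → ∀ e → Remaining c i e →
       ∃[ f ] ((c f ≡ i × SameComp (Remaining c i) e f × Balanced (Remaining c i) f)
              × (∀ g → c g ≡ i → SameComp (Remaining c i) e g → g ≡ f)))

  DepthIs : (Fin m → ℕ) → ℕ → Set
  DepthIs c d = (∀ e → c e ≤ d) × (∃[ e ] c e ≡ d)

  MinDepthIs : ℕ → Set
  MinDepthIs D = (∃[ c ] (Execution c × DepthIs c D))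
               × (∀ c d → Execution c → DepthIs c d → D ≤ d)

module Submission where

-- The only property of an execution the argument uses is that in iteration i
-- each component of the current forest Fᵢ (the edges of colour ≥ i) contains
-- at most one edge of colour i.  Given distinct vertices u, v take the path
-- P joining them and an edge g of P of least colour i.  Every edge of P has
-- colour ≥ i, so P lies in Fᵢ and all its edges lie in one component of Fᵢ;
-- therefore g is the only edge of colour i on P, and P is conflict-free.
--
-- The bound cfc(T) ≤ D(T) follows because an execution
-- of depth D uses the colours 1, …, D only.

open import Defs
open import Data.Nat using (ℕ; suc; _≤_; _≟_)
open import Data.Nat.Properties using (≤-refl)
open import Data.Fin using (Fin)
import Data.Fin as Fin
open import Data.Product using (_×_; _,_; proj₁; proj₂; ∃-syntax)
open import Data.Sum using (inj₁; inj₂)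
open import Data.Empty using (⊥; ⊥-elim)
open import Data.List using (List; []; _∷_; length; filter; applyUpTo)
open import Data.List.Properties using (length-applyUpTo)
open import Data.List.Membership.Propositional using (_∈_)
open import Data.List.Membership.Propositional.Properties
  using (∈-filter⁺; ∈-filter⁻; ∈-applyUpTo⁺)
open import Data.List.Relation.Unary.Any using (here; there)
open import Data.List.Relation.Unary.All using (All; []; _∷_; lookup; tabulate)
open import Data.List.Relation.Unary.All.Properties using (¬Any⇒All¬)
open import Data.List.Relation.Unary.AllPairs using ([]; _∷_)
open import Data.List.Relation.Unary.Unique.Propositional using (Unique)
open import Data.List.Relation.Unary.Unique.Propositional.Properties
  using () renaming (filter⁺ to unique-filter)
open import Data.List.Extrema.Nat using (argmin; argmin-sel; f[argmin]≤f[⊤]; f[argmin]≤f[xs])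
open import Relation.Binary.PropositionalEquality using (_≡_; _≢_; refl; sym; trans; subst)
open import Relation.Nullary using (Dec; yes; no)

least : {A : Set} (key : A → ℕ) (xs : List A) → xs ≢ [] →
        ∃[ g ] (g ∈ xs × ∀ x → x ∈ xs → key g ≤ key x)
least key [] nonempty = ⊥-elim (nonempty refl)
least key (y ∷ ys) _ = argmin key y ys , member , λ _ → lookup lowerBound
  where
  member : argmin key y ys ∈ y ∷ ys
  member with argmin-sel key y ys
  ... | inj₁ isHead = here isHead
  ... | inj₂ inTail = there inTail

  lowerBound : All (λ x → key (argmin key y ys) ≤ key x) (y ∷ ys)
  lowerBound = f[argmin]≤f[⊤] {f = key} y ys ∷ f[argmin]≤f[xs] {f = key} y ys

unique-singleton : {A : Set} {f : A} {xs : List A} → Unique xs → f ∈ xs →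
                   (∀ x → x ∈ xs → x ≡ f) → length xs ≡ 1
unique-singleton {xs = _ ∷ []} _ _ _ = refl
unique-singleton {xs = x ∷ y ∷ _} ((x≢y ∷ _) ∷ _) _ allF =
  ⊥-elim (x≢y (trans (allF x (here refl)) (sym (allF y (there (here refl))))))

∈-positives : ∀ {x D} → 1 ≤ x → x ≤ D → x ∈ applyUpTo suc D
∈-positives {suc k} _ k<D = ∈-applyUpTo⁺ suc k<D

module _ {n m : ℕ} (E : EdgeMap n m) where

  open import Data.List.Membership.DecPropositional (Fin._≟_ {n}) using (_∈?_)

  joins-sym : ∀ {e u w} → Joins E e u w → Joins E e w u
  joins-sym (inj₁ p) = inj₂ p
  joins-sym (inj₂ p) = inj₁ p

  reach-trans : ∀ {S a b c} → Reach E S a b → Reach E S b c → Reach E S a c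
  reach-trans (_ , _ , here) r = r
  reach-trans (_ , _ , step e s j w) r with reach-trans (_ , _ , w) r
  ... | (_ , _ , w′) = _ , _ , step e s j w′

  reach-sym : ∀ {S a b} → Reach E S a b → Reach E S b a
  reach-sym (_ , _ , here) = _ , _ , here
  reach-sym (_ , _ , step e s j w) =
    reach-trans (reach-sym (_ , _ , w)) (_ , _ , step e s (joins-sym j) here)

  start∈ : ∀ {S u v vs es} → Walk E S u v vs es → u ∈ vs
  start∈ here = here refl
  start∈ (step _ _ _ _) = here refl

  reach-visited : ∀ {S u v vs es x} → Walk E S u v vs es → x ∈ vs → Reach E S u x
  reach-visited here (here refl) = _ , _ , here
  reach-visited (step e s j w) (here refl) = _ , _ , here
  reach-visited (step e s j w) (there p) =
    reach-trans (_ , _ , step e s j here) (reach-visited w p)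

  endpoints∈ : ∀ {S u v vs es e} → Walk E S u v vs es → e ∈ es →
               proj₁ (E e) ∈ vs × proj₂ (E e) ∈ vs
  endpoints∈ (step e s (inj₁ p) w) (here refl) rewrite p = here refl , there (start∈ w)
  endpoints∈ (step e s (inj₂ p) w) (here refl) rewrite p = there (start∈ w) , here refl
  endpoints∈ (step e s j w) (there p) with endpoints∈ w p
  ... | (a , b) = there a , there b

  walk-sameComp : ∀ {S u v vs es g h} → Walk E S u v vs es → g ∈ es → h ∈ es →
                  SameComp E S g h
  walk-sameComp w g∈ h∈ =
    reach-trans (reach-sym (reach-visited w (proj₁ (endpoints∈ w g∈))))
                (reach-visited w (proj₁ (endpoints∈ w h∈)))

  restrict : ∀ {S S′ u v vs es} → Walk E S u v vs es → (∀ e → e ∈ es → S′ e) →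
             Walk E S′ u v vs es
  restrict here _ = here
  restrict (step e s j w) inS′ =
    step e (inS′ e (here refl)) j (restrict w (λ g p → inS′ g (there p)))

  path-from : ∀ {S w v vs es u} → Walk E S w v vs es → u ∈ vs → Unique vs →
              ∃[ vs′ ] ∃[ es′ ] Path E S u v vs′ es′
  path-from here (here refl) uq = _ , _ , here , uq
  path-from (step e s j w) (here refl) uq = _ , _ , step e s j w , uq
  path-from (step e s j w) (there p) (_ ∷ uq) = path-from w p uq

  -- Every walk shrinks to a path with the same ends (cut out closed subwalks).
  walk→path : ∀ {S u v vs es} → Walk E S u v vs es → ∃[ vs′ ] ∃[ es′ ] Path E S u v vs′ es′
  walk→path here = _ , _ , here , ([] ∷ [])
  walk→path {u = u} (step e s j w) with walk→path w
  ... | (vs′ , _ , w′ , uq) with u ∈? vs′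
  ...   | yes u∈ = path-from w′ u∈ uq
  ...   | no u∉ = _ , _ , step e s j w′ , (¬Any⇒All¬ vs′ u∉ ∷ uq)

  -- A path uses no edge twice: an edge occurring again later would bring the
  -- first vertex back.
  path-edges-unique : ∀ {S u v vs es} → Walk E S u v vs es → Unique vs → Unique es
  path-edges-unique here _ = []
  path-edges-unique {u = u} (step {vs = vs} {es = es} e s j w) (u∉ ∷ uq) =
    tabulate revisits ∷ path-edges-unique w uq
    where
    returnsTo-u : ∀ {x} → Joins E e u x → proj₁ (E e) ∈ vs × proj₂ (E e) ∈ vs → ⊥
    returnsTo-u (inj₁ p) (a , _) = lookup u∉ (subst (λ q → proj₁ q ∈ vs) p a) refl
    returnsTo-u (inj₂ p) (_ , b) = lookup u∉ (subst (λ q → proj₂ q ∈ vs) p b) refl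

    revisits : ∀ {g} → g ∈ es → e ≢ g
    revisits g∈ refl = returnsTo-u j (endpoints∈ w g∈)

  OnePerComponent : (Fin m → ℕ) → Set
  OnePerComponent c = ∀ i g h → c g ≡ i → c h ≡ i →
                      SameComp E (Remaining E c i) g h → g ≡ h

  execution-onePerComponent : ∀ c → Execution E c → OnePerComponent c
  execution-onePerComponent c (positive , iteration) i g h cg≡i ch≡i g~h
    with iteration i (subst (1 ≤_) cg≡i (positive g)) g (subst (_≤ c g) cg≡i ≤-refl)
  ... | (_ , _ , deletedOnce) =
    trans (deletedOnce g cg≡i (_ , _ , here)) (sym (deletedOnce h ch≡i g~h))

  least-colour-unique : ∀ c → OnePerComponent c → ∀ {S u v vs es} →
                        Walk E S u v vs es → Unique es → es ≢ [] → ConflictFree E c es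
  least-colour-unique c onePer {u = u} {v = v} {vs = vs} {es = es} w uq nonempty
    with least c es nonempty
  ... | (g , g∈ , minimal) = c g , singleton
    where
    P? : (e : Fin m) → Dec (c e ≡ c g)
    P? e = c e ≟ c g

    -- the whole walk survives until iteration c g
    survives : Walk E (Remaining E c (c g)) u v vs es
    survives = restrict w minimal

    onlyG : ∀ x → x ∈ filter P? es → x ≡ g
    onlyG x x∈ with ∈-filter⁻ P? x∈
    ... | (x∈es , cx≡cg) = sym (onePer (c g) g x refl cx≡cg (walk-sameComp survives g∈ x∈es))

    singleton : length (filter P? es) ≡ 1
    singleton = unique-singleton (unique-filter P? uq) (∈-filter⁺ P? g∈ refl) onlyG

  onePerComponent-cfc : Connected E (AllEdges E) → ∀ c → OnePerComponent c →
                        IsCFCColoring E c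
  onePerComponent-cfc connected c onePer u v u≢v
    with walk→path (proj₂ (proj₂ (connected u v)))
  ... | (vs , es , w , uq) =
    vs , es , (w , uq) , least-colour-unique c onePer w (path-edges-unique w uq) (nonempty w)
    where
    nonempty : ∀ {vs′ es′} → Walk E (AllEdges E) u v vs′ es′ → es′ ≢ []
    nonempty here refl = u≢v refl
    nonempty (step _ _ _ _) ()

  execution-usesAtMost : ∀ c D → Execution E c → DepthIs E c D → UsesAtMost E D c
  execution-usesAtMost c D (positive , _) (bounded , _) =
    applyUpTo suc D , subst (_≤ D) (sym (length-applyUpTo suc D)) ≤-refl ,
    λ e → ∈-positives (positive e) (bounded e)

theorem3p4 : ∀ {n m : ℕ} (E : EdgeMap n m) → IsTree E → 2 ≤ n →
    (∀ (c : Fin m → ℕ) → Execution E c → IsCFCColoring E c)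
    × (∀ k D → IsCfc E k → MinDepthIs E D → k ≤ D)
theorem3p4 E (_ , connected , _) _ = outputIsCfc , cfc≤D
  where
  outputIsCfc : ∀ c → Execution E c → IsCFCColoring E c
  outputIsCfc c ex = onePerComponent-cfc E connected c (execution-onePerComponent E c ex)

  cfc≤D : ∀ k D → IsCfc E k → MinDepthIs E D → k ≤ D
  cfc≤D k D (_ , minimal) ((c , ex , depth) , _) =
    minimal D c (execution-usesAtMost E c D ex depth) (outputIsCfc c ex)
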